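{- Let $P$ be a dcpo. For every directed subset $\mathcal{F}=\{{\downarrow}F_i\}_{i\in I}$ of $\mathcal{L}P$, $$cl_{\mathcal{L}P}(\mathcal{F})=\{{\downarrow}F: F \text{ a nonempty finite subset of } cl_{\Sigma P}(\textstyle\bigcup\mathcal{F})\}.$$
   Context: $LP=\{{\downarrow}F: F \text{ nonempty finite}\subseteq P\}$, ordered by inclusion. For an inclusion-directed $\mathcal{F}\subseteq LP$ and ${\downarrow}F\in LP$, write $\mathcal{F}\Rightarrow_L{\downarrow}F$ iff for each $x\in F$ there is a directed subset $D$ of $P$ with $D\subseteq\bigcup\mathcal{F}$ converging to $x$ in the Scott space $\Sigma P$ (i.e. meeting every Scott-open neighbourhood of $x$). $\mathcal{L}P=(LP,O_{\Rightarrow_L}(LP))$, where $\mathcal{U}\subseteq LP$ is open iff $\mathcal{F}\Rightarrow_L{\downarrow}F\in\mathcal{U}$ implies $\mathcal{F}\cap\mathcal{U}\neq\emptyset$. $cl_{\mathcal{L}P}$ and $cl_{\Sigma P}$ are closures in $\mathcal{L}P$ and in $\Sigma P$ respectively. -}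

module Defs where

open import Level using (Level; suc; _⊔_)
open import Data.Product using (Σ; ∃; _×_; _,_)
open import Data.List.NonEmpty using (List⁺; toList)
open import Data.List.Membership.Propositional using (_∈_)
open import Relation.Binary.Bundles using (Poset)
open import Relation.Unary using (Pred; _⊆_)

module _ {ℓ : Level} (P : Poset ℓ ℓ ℓ) where
  open Poset P

  Subset : Set (suc ℓ)
  Subset = Pred Carrier ℓ

  Directed : Subset → Set ℓ
  Directed D = (∃ λ d → D d)
             × (∀ {a b} → D a → D b → ∃ λ c → D c × a ≤ c × b ≤ c)

  IsUpperBound : Subset → Carrier → Set ℓ
  IsUpperBound D u = ∀ {d} → D d → d ≤ u

  IsSup : Subset → Carrier → Set ℓ
  IsSup D s = IsUpperBound D s × (∀ {u} → IsUpperBound D u → s ≤ u)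

  IsDcpo : Set (suc ℓ)
  IsDcpo = ∀ (D : Subset) → Directed D → ∃ λ s → IsSup D s

  IsScottOpen : Subset → Set (suc ℓ)
  IsScottOpen U = (∀ {x y} → x ≤ y → U x → U y)
                × (∀ (D : Subset) (s : Carrier) → Directed D → IsSup D s → U s
                     → ∃ λ d → D d × U d)

  clΣ : Subset → Carrier → Set (suc ℓ)
  clΣ A x = ∀ (U : Subset) → IsScottOpen U → U x → ∃ λ y → A y × U y

  ConvergesTo : Subset → Carrier → Set (suc ℓ)
  ConvergesTo D x = ∀ (U : Subset) → IsScottOpen U → U x → ∃ λ d → D d × U d

  -- Elements of LP are represented by codes: nonempty finite lists F, standing for ↓F.
  LCode : Set ℓ
  LCode = List⁺ Carrier

  ↓_ : LCode → Subset
  (↓ F) x = ∃ λ y → y ∈ toList F × x ≤ y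

  _⊑_ : LCode → LCode → Set ℓ
  F ⊑ G = ↓ F ⊆ ↓ G

  LSubset : Set (suc ℓ)
  LSubset = Pred LCode ℓ

  LDirected : LSubset → Set ℓ
  LDirected 𝓕 = (∃ λ F → 𝓕 F)
              × (∀ {F G} → 𝓕 F → 𝓕 G → ∃ λ H → 𝓕 H × F ⊑ H × G ⊑ H)

  ⋃ : LSubset → Subset
  ⋃ 𝓕 x = ∃ λ F → 𝓕 F × (↓ F) x

  _⇒L_ : LSubset → LCode → Set (suc ℓ)
  𝓕 ⇒L F = ∀ x → x ∈ toList F →
             ∃ λ (D : Subset) → Directed D × D ⊆ ⋃ 𝓕 × ConvergesTo D x

  IsLOpen : LSubset → Set (suc ℓ)
  IsLOpen 𝓤 = ∀ (𝓕 : LSubset) (F : LCode) → LDirected 𝓕 → 𝓕 ⇒L F → 𝓤 F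
              → ∃ λ G → 𝓕 G × 𝓤 G

  clL : LSubset → LCode → Set (suc ℓ)
  clL 𝓐 F = ∀ (𝓤 : LSubset) → IsLOpen 𝓤 → 𝓤 F → ∃ λ G → 𝓐 G × 𝓤 G

module Submission where

open import Defs
open import Level using (Level)
open import Data.Product using (∃; _×_; _,_; proj₁; proj₂)
open import Data.List using (List; []; _∷_; _++_)
open import Data.List.NonEmpty using (toList) renaming (_∷_ to _∷⁺_)
open import Data.List.Membership.Propositional using (_∈_)
open import Data.List.Relation.Binary.Subset.Propositional using () renaming (_⊆_ to _⊆ˡ_)
open import Data.List.Relation.Binary.Permutation.Propositional.Properties using (shift; ∈-resp-↭)
open import Data.List.Relation.Unary.Any using (here; there)
open import Data.List.Relation.Unary.All as All using (All; []; _∷_)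
open import Data.List.Relation.Unary.All.Properties using (++⁺)
open import Relation.Binary.Bundles using (Poset)
open import Relation.Binary.PropositionalEquality using (_≡_; refl)
open import Relation.Unary using (_⊆_)
open import Function.Bundles using (_⇔_; mk⇔)

-- An L-open set 𝓤 is an upper set, and for every list R the section z ↦ 𝓤 (z ∷ R) is
-- Scott open: directed sups in the first coordinate give ⇒_L-convergent families.
-- Hence if ↓F ∈ 𝓤 with F ⊆ cl(⋃𝓕), the elements of F can be replaced one at a time by
-- elements of ⋃𝓕; by directedness the resulting finite set lies in some member of 𝓕,
-- which is then in 𝓤. Conversely, a Scott-open U yields the L-open set of all ↓F
-- meeting U, so every element of a point of cl(𝓕) lies in cl(⋃𝓕).

module _ {ℓ : Level} (P : Poset ℓ ℓ ℓ) where
  open Poset P renaming (refl to ≤-refl; trans to ≤-trans)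

  singleton-directed : (x : Carrier) → Directed P (_≡ x)
  singleton-directed x = (x , refl) , λ { refl refl → x , refl , ≤-refl , ≤-refl }

  singleton-convergesTo : (x : Carrier) → ConvergesTo P (_≡ x) x
  singleton-convergesTo x U _ Ux = x , refl , Ux

  ↓-downward : ∀ {F x y} → x ≤ y → (↓_ P F) y → (↓_ P F) x
  ↓-downward x≤y (w , w∈F , y≤w) = w , w∈F , ≤-trans x≤y y≤w

  ⊑-from-members : ∀ {F G} → (∀ {z} → z ∈ toList F → (↓_ P G) z) → _⊑_ P F G
  ⊑-from-members members (w , w∈F , z≤w) = ↓-downward z≤w (members w∈F)

  ⊑-from-⊆ : ∀ {F G} → toList F ⊆ˡ toList G → _⊑_ P F G
  ⊑-from-⊆ F⊆G = ⊑-from-members λ w∈F → _ , F⊆G w∈F , ≤-refl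

  ∷⁺-mono : ∀ {a b} (R : List Carrier) → a ≤ b → _⊑_ P (a ∷⁺ R) (b ∷⁺ R)
  ∷⁺-mono R a≤b (w , here refl , z≤w) = _ , here refl , ≤-trans z≤w a≤b
  ∷⁺-mono R a≤b (w , there w∈R , z≤w) = w , there w∈R , z≤w

  ∈⋃⇒approached : ∀ {𝓖 x} → ⋃ P 𝓖 x →
                  ∃ λ (D : Subset P) → Directed P D × D ⊆ ⋃ P 𝓖 × ConvergesTo P D x
  ∈⋃⇒approached {x = x} x∈⋃ =
    (_≡ x) , singleton-directed x , (λ { refl → x∈⋃ }) , singleton-convergesTo x

  singleton-LDirected : (H : LCode P) → LDirected P (_≡ H)
  singleton-LDirected H = (H , refl) , λ { refl refl → H , refl , (λ {_} z → z) , (λ {_} z → z) }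

  IsLOpen⇒upward : ∀ {𝓤} → IsLOpen P 𝓤 → ∀ {F G} → _⊑_ P F G → 𝓤 F → 𝓤 G
  IsLOpen⇒upward {𝓤} 𝓤-open {F} {G} F⊑G UF
    with 𝓤-open (_≡ G) F (singleton-LDirected G) approach UF
    where
    approach : _⇒L_ P (_≡ G) F
    approach x x∈F = ∈⋃⇒approached (G , refl , F⊑G (x , x∈F , ≤-refl))
  ... | .G , refl , UG = UG

  IsLOpen⇒section-isScottOpen : ∀ {𝓤} → IsLOpen P 𝓤 → (R : List Carrier) →
                                IsScottOpen P (λ z → 𝓤 (z ∷⁺ R))
  IsLOpen⇒section-isScottOpen {𝓤} 𝓤-open R =
    (λ a≤b → IsLOpen⇒upward 𝓤-open (∷⁺-mono R a≤b)) , inaccessible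
    where
    inaccessible : ∀ D s → Directed P D → IsSup P D s → 𝓤 (s ∷⁺ R) → ∃ λ d → D d × 𝓤 (d ∷⁺ R)
    inaccessible D s D-dir@((d₀ , Dd₀) , D-bound) s-sup Us
      with 𝓤-open 𝓓 (s ∷⁺ R) 𝓓-dir approach Us
      where
      𝓓 : LSubset P
      𝓓 H = ∃ λ d → D d × H ≡ d ∷⁺ R

      𝓓-dir : LDirected P 𝓓
      𝓓-dir = (d₀ ∷⁺ R , d₀ , Dd₀ , refl) , λ { (a , Da , refl) (b , Db , refl) →
        let (c , Dc , a≤c , b≤c) = D-bound Da Db
        in c ∷⁺ R , (c , Dc , refl) , ∷⁺-mono R a≤c , ∷⁺-mono R b≤c }

      approach : _⇒L_ P 𝓓 (s ∷⁺ R)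
      approach x (here refl) =
        D , D-dir , (λ {d} Dd → d ∷⁺ R , (d , Dd , refl) , d , here refl , ≤-refl)
          , λ U (_ , U-inaccessible) → U-inaccessible D s D-dir s-sup
      approach x (there x∈R) = ∈⋃⇒approached (d₀ ∷⁺ R , (d₀ , Dd₀ , refl) , x , there x∈R , ≤-refl)
    ... | .(d ∷⁺ R) , (d , Dd , refl) , Ud = d , Dd , Ud

  IsScottOpen⇒meeting-isLOpen : ∀ {U} → IsScottOpen P U →
                                IsLOpen P (λ H → ∃ λ y → y ∈ toList H × U y)
  IsScottOpen⇒meeting-isLOpen U-open 𝓖 F _ 𝓖⇒F (y , y∈F , Uy)
    with 𝓖⇒F y y∈F
  ... | D , _ , D⊆⋃𝓖 , D→y with D→y _ U-open Uy
  ... | d , Dd , Ud with D⊆⋃𝓖 Dd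
  ... | H , 𝓖H , w , w∈H , d≤w = H , 𝓖H , w , w∈H , proj₁ U-open d≤w Ud

  module _ {A : Subset P} {𝓤 : LSubset P} (𝓤-open : IsLOpen P 𝓤) where

    replace-head : (R : List Carrier) {x : Carrier} → clΣ P A x → 𝓤 (x ∷⁺ R) →
                   ∃ λ y → A y × 𝓤 (y ∷⁺ R)
    replace-head R x∈clA = x∈clA _ (IsLOpen⇒section-isScottOpen 𝓤-open R)

    -- ys are the elements already replaced, xs those still in the closure.
    replace-members : (ys xs : List Carrier) → All A ys → All (clΣ P A) xs →
                      (C : LCode P) → toList C ⊆ˡ ys ++ xs → 𝓤 C →
                      ∃ λ S → All A (toList S) × 𝓤 S
    replace-members ys [] Ays [] C C⊆ UC =
      C , All.tabulate (λ z∈C → All.lookup (++⁺ Ays []) (C⊆ z∈C)) , UC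
    replace-members ys (x ∷ xs) Ays (x∈clA ∷ xs⊆clA) C C⊆ UC
      with replace-head (ys ++ xs) x∈clA (IsLOpen⇒upward 𝓤-open (⊑-from-⊆ C⊆x∷) UC)
      where
      C⊆x∷ : toList C ⊆ˡ x ∷ ys ++ xs
      C⊆x∷ z∈C = ∈-resp-↭ (shift x ys xs) (C⊆ z∈C)
    ... | y , Ay , Uy = replace-members (y ∷ ys) xs (Ay ∷ Ays) xs⊆clA (y ∷⁺ ys ++ xs) (λ z → z) Uy

  module _ {𝓕 : LSubset P} (𝓕-dir : LDirected P 𝓕) where

    LDirected⇒finite-bound : (xs : List Carrier) → All (⋃ P 𝓕) xs →
                             ∃ λ H → 𝓕 H × (∀ {z} → z ∈ xs → (↓_ P H) z)
    LDirected⇒finite-bound [] [] = proj₁ (proj₁ 𝓕-dir) , proj₂ (proj₁ 𝓕-dir) , λ ()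
    LDirected⇒finite-bound (x ∷ xs) ((Hx , 𝓕Hx , x∈↓Hx) ∷ xs⊆⋃)
      with LDirected⇒finite-bound xs xs⊆⋃
    ... | H , 𝓕H , xs⊆↓H with proj₂ 𝓕-dir 𝓕Hx 𝓕H
    ... | K , 𝓕K , Hx⊑K , H⊑K = K , 𝓕K , λ { (here refl) → Hx⊑K x∈↓Hx ; (there z∈xs) → H⊑K (xs⊆↓H z∈xs) }

    clL⇒members-clΣ : ∀ {G} → clL P 𝓕 G → ∀ x → x ∈ toList G → clΣ P (⋃ P 𝓕) x
    clL⇒members-clΣ G∈cl x x∈G U U-open Ux
      with G∈cl _ (IsScottOpen⇒meeting-isLOpen U-open) (x , x∈G , Ux)
    ... | H , 𝓕H , y , y∈H , Uy = y , (H , 𝓕H , y , y∈H , ≤-refl) , Uy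

    members-clΣ⇒clL : ∀ {F} → (∀ x → x ∈ toList F → clΣ P (⋃ P 𝓕) x) → clL P 𝓕 F
    members-clΣ⇒clL {F} F⊆cl 𝓤 𝓤-open UF
      with replace-members 𝓤-open [] (toList F) [] (All.tabulate (F⊆cl _)) F (λ z → z) UF
    ... | S , S⊆⋃ , US with LDirected⇒finite-bound (toList S) S⊆⋃
    ... | H , 𝓕H , S⊆↓H = H , 𝓕H , IsLOpen⇒upward 𝓤-open (⊑-from-members S⊆↓H) US

proposition5p12 : ∀ {ℓ : Level} (P : Poset ℓ ℓ ℓ) → IsDcpo P →
    (𝓕 : LSubset P) → LDirected P 𝓕 → (G : LCode P) →
    clL P 𝓕 G ⇔ (∃ λ (F : LCode P) → (∀ x → x ∈ toList F → clΣ P (⋃ P 𝓕) x)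
    × (_⊑_ P F G × _⊑_ P G F))
proposition5p12 P _ 𝓕 𝓕-dir G = mk⇔
  (λ G∈cl → G , clL⇒members-clΣ P 𝓕-dir G∈cl , (λ {_} z → z) , (λ {_} z → z))
  (λ { (F , F⊆cl , _ , G⊑F) 𝓤 𝓤-open UG →
         members-clΣ⇒clL P 𝓕-dir F⊆cl 𝓤 𝓤-open (IsLOpen⇒upward P 𝓤-open G⊑F UG) })
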